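{- Let $R$ be a commutative ring with identity and let $\boldsymbol{a}=(a_0,a_1,a_2,\dots)\in H_R$ with $a_0\in R^*$. Then $$\boldsymbol{a}^{ -1}=\lambda_{ - }\left(\lambda_{+,0}(\boldsymbol{a})^{(-1)}\right)\circ\lambda_{+,0}(\boldsymbol{a}).$$
   Context: $H_R$ denotes the set of all sequences $\boldsymbol{a}=(a_n)_{n\ge0}$ with $a_n\in R$, and $R^*$ the group of units of $R$. The Hurwitz (binomial convolution) product is $(\boldsymbol{a}\star\boldsymbol{b})_n=\sum_{h=0}^n\binom{n}{h}a_hb_{n-h}$; its identity is $(1,0,0,\dots)$, and $\boldsymbol{a}^{ -1}$ denotes the inverse of $\boldsymbol{a}$ with respect to $\star$ (which exists iff $a_0\in R^*$). For $n,h\ge0$ let $B^{e}_{n,h}$ be the exponential partial Bell polynomial: $B^e_{0,0}=1$, $B^e_{n,0}=0$ for $n\ge1$, $B^e_{0,h}=0$ for $h\ge1$, and otherwise $B^{e}_{n,h}(y_1,y_2,\dots)=\sum \frac{n!}{\prod_i j_i!\,(i!)^{j_i}}\prod_i y_i^{j_i}$, summed over nonnegative integers $j_1,\dots,j_n$ with $\sum_i j_i=h$ and $\sum_i i j_i=n$. For $\boldsymbol{a}\in H_R$ and $\boldsymbol{b}\in H_R$ with $b_0=0$, the composition product is $(\boldsymbol{a}\circ\boldsymbol{b})_n=\sum_{h=0}^n a_hB^e_{n,h}(b_1,\dots,b_{n-h+1})$; this corresponds to composition of exponential generating functions $A(B(t))$, where $A(t)=\sum a_h t^h/h!$. The identity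 for $\circ$ is $(0,1,0,0,\dots)$, and a sequence $\boldsymbol{c}$ with $c_0=0$, $c_1\in R^*$ has a unique two-sided $\circ$-inverse, denoted $\boldsymbol{c}^{(-1)}$. The shift $\lambda_-$ maps $(a_0,a_1,a_2,\dots)\mapsto(a_1,a_2,\dots)$, and $\lambda_{+,0}$ maps $(a_0,a_1,\dots)\mapsto(0,a_0,a_1,\dots)$. -}

module Defs where

open import Level using (Level)
open import Algebra.Bundles using (CommutativeRing)
open import Data.Nat as ℕ using (ℕ; zero; suc)
open import Data.Nat.DivMod using (_/_)
open import Data.Nat.Combinatorics using (_C_)
open import Data.Fin using (Fin; toℕ)
open import Data.List using (List; []; _∷_; concatMap; map; filterᵇ; upTo)
open import Data.Vec using (Vec; []; _∷_; lookup)
open import Data.Bool using (_∧_)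
open import Data.Product using (∃; _×_)

fact : ℕ → ℕ
fact zero = 1
fact (suc n) = suc n ℕ.* fact n

-- natural division, total (divisor 0 gives 0; never used with 0 below)
divℕ : ℕ → ℕ → ℕ
divℕ m zero = 0
divℕ m (suc d) = m / suc d

-- all vectors (j_1,…,j_n) with entries in {0,…,n}: index k : Fin n stands for i = k+1
vecsBelow : ℕ → (m : ℕ) → List (Vec ℕ m)
vecsBelow b zero = [] ∷ []
vecsBelow b (suc m) = concatMap (λ x → map (x ∷_) (vecsBelow b m)) (upTo (suc b))

sumF : (n : ℕ) → (Fin n → ℕ) → ℕ
sumF zero f = 0
sumF (suc n) f = f Data.Fin.zero ℕ.+ sumF n (λ k → f (Data.Fin.suc k))

prodF : (n : ℕ) → (Fin n → ℕ) → ℕ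
prodF zero f = 1
prodF (suc n) f = f Data.Fin.zero ℕ.* prodF n (λ k → f (Data.Fin.suc k))

module Hurwitz {c ℓ : Level} (R : CommutativeRing c ℓ) where
  open CommutativeRing R

  Seq : Set c
  Seq = ℕ → Carrier

  _≋_ : Seq → Seq → Set ℓ
  a ≋ b = ∀ n → a n ≈ b n

  IsUnit : Carrier → Set (c Level.⊔ ℓ)
  IsUnit x = ∃ λ u → (x * u ≈ 1#) × (u * x ≈ 1#)

  fromℕ : ℕ → Carrier
  fromℕ zero = 0#
  fromℕ (suc n) = 1# + fromℕ n

  pow : Carrier → ℕ → Carrier
  pow x zero = 1#
  pow x (suc k) = x * pow x k

  sumR : List Carrier → Carrier
  sumR [] = 0#
  sumR (x ∷ xs) = x + sumR xs

  prodFR : (n : ℕ) → (Fin n → Carrier) → Carrier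
  prodFR zero f = 1#
  prodFR (suc n) f = f Data.Fin.zero * prodFR n (λ k → f (Data.Fin.suc k))

  _⋆_ : Seq → Seq → Seq
  (a ⋆ b) n = sumR (map (λ h → fromℕ (n C h) * (a h * b (n ℕ.∸ h))) (upTo (suc n)))

  𝟏 : Seq
  𝟏 zero = 1#
  𝟏 (suc n) = 0#

  𝕀 : Seq
  𝕀 (suc zero) = 1#
  𝕀 _ = 0#

  -- exponential partial Bell polynomial B^e_{n,h}(y_1,y_2,…), y : Seq with y i = y_i
  -- (summed over j_1..j_n ≥ 0 with Σ j_i = h, Σ i j_i = n; each j_i ≤ n automatically)
  bellCoeff : (n : ℕ) → Vec ℕ n → ℕ
  bellCoeff n j = divℕ (fact n)
    (prodF n (λ k → fact (lookup j k) ℕ.* (fact (suc (toℕ k)) ℕ.^ lookup j k)))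

  bellTerm : (n : ℕ) → Seq → Vec ℕ n → Carrier
  bellTerm n y j = fromℕ (bellCoeff n j) * prodFR n (λ k → pow (y (suc (toℕ k))) (lookup j k))

  bellOK : (n h : ℕ) → Vec ℕ n → Data.Bool.Bool
  bellOK n h j = (sumF n (λ k → lookup j k) ℕ.≡ᵇ h)
               ∧ (sumF n (λ k → suc (toℕ k) ℕ.* lookup j k) ℕ.≡ᵇ n)

  Bell : ℕ → ℕ → Seq → Carrier
  Bell zero zero y = 1#
  Bell (suc n) zero y = 0#
  Bell zero (suc h) y = 0#
  Bell (suc n) (suc h) y =
    sumR (map (bellTerm (suc n) y) (filterᵇ (bellOK (suc n) (suc h)) (vecsBelow (suc n) (suc n))))

  -- composition product (meaningful when b 0 ≈ 0; the Bell polynomial only uses b_1, b_2, …)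
  _∘ₕ_ : Seq → Seq → Seq
  (a ∘ₕ b) n = sumR (map (λ h → a h * Bell n h b) (upTo (suc n)))

  λ₋ : Seq → Seq
  λ₋ a n = a (suc n)

  λ₊₀ : Seq → Seq
  λ₊₀ a zero = 0#
  λ₊₀ a (suc n) = a n

  IsStarInverse : Seq → Seq → Set ℓ
  IsStarInverse a b = ((a ⋆ b) ≋ 𝟏) × ((b ⋆ a) ≋ 𝟏)

  IsCompInverse : Seq → Seq → Set ℓ
  IsCompInverse c d = (d 0 ≈ 0#) × ((c ∘ₕ d) ≋ 𝕀) × ((d ∘ₕ c) ≋ 𝕀)

-- Read as exponential generating functions, λ₋ is differentiation, ⋆ is the product and ∘ₕ is
-- composition. With C = λ₊₀ a (an antiderivative of A) and D its compositional inverse,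
-- differentiating D ∘ C = t gives (D′ ∘ C) ⋆ A = 1, so D′ ∘ C is a left inverse of a, and a left
-- inverse of a sequence with invertible constant term is unique. The chain rule behind this comes
-- from the Bell polynomial recurrence B_{n+1,h+1} = Σₖ (n choose k) B_{k,h} y_{n-k+1}, obtained by
-- classifying set partitions of {0,…,n} by the size of the block containing n; the coefficients
-- n!/∏ jᵢ!(i!)^{jᵢ} of the explicit formula obey the same recursion, which is also what shows that
-- the division defining them is exact.

module Submission where

open import Defs
open import Level using (Level)
open import Algebra.Bundles using (CommutativeRing)
open import Data.Nat using (zero; suc)
open import Data.Product using (_,_)

module BlockMultiplicities where
  open import Data.Nat
    using (ℕ; zero; suc; pred; _+_; _*_; _∸_; _^_; _≤_; _<_; z≤n; s≤s; _≤ᵇ_; _≡ᵇ_; _!; NonZero)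
  open import Data.Nat.Properties
  open import Data.Nat.Combinatorics using (_C_; k![n∸k]!∣n!)
  open import Data.Nat.Combinatorics.Specification using (nCk≡n!/k![n-k]!)
  open import Data.Nat.DivMod using (m/n*n≡m; m*n/n≡m)
  open import Data.Nat.Induction using (<-rec)
  open import Data.Nat.Tactic.RingSolver using (solve-∀)
  open import Data.Fin as Fin using (Fin; toℕ; inject₁)
  open import Data.Fin.Properties using (toℕ-inject₁; toℕ-fromℕ)
  open import Data.Vec using (Vec; []; _∷_; lookup; _∷ʳ_; _[_]%=_)
  open import Data.Vec.Properties using (lookup∘updateAt; updateAt-updateAt; updateAt-id; updateAt-id-local)
  open import Data.Bool using (Bool; true; T; _∧_; if_then_else_)
  open import Data.Bool.Properties using (∧-conicalˡ; ∧-conicalʳ)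
  open import Data.Product using (_×_; _,_)
  open import Function using (_∘_)
  open import Relation.Binary.PropositionalEquality

  fact≡! : ∀ n → fact n ≡ n !
  fact≡! zero = refl
  fact≡! (suc n) = cong (suc n *_) (fact≡! n)

  fact-nonZero : ∀ n → NonZero (fact n)
  fact-nonZero n rewrite fact≡! n = n !≢0

  C*fact*fact≡fact : ∀ {n k} → k ≤ n → (n C k) * (fact k * fact (n ∸ k)) ≡ fact n
  C*fact*fact≡fact {n} {k} k≤n rewrite fact≡! k | fact≡! (n ∸ k) | fact≡! n =
    trans (cong (_* (k ! * (n ∸ k) !)) (nCk≡n!/k![n-k]! k≤n))
          (m/n*n≡m {{k !* (n ∸ k) !≢0}} (k![n∸k]!∣n! k≤n))

  divℕ-*-cancelʳ : ∀ q p → .{{NonZero p}} → divℕ (q * p) p ≡ q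
  divℕ-*-cancelʳ q (suc p) = m*n/n≡m q (suc p)

  sumF-cong : ∀ n {f g : Fin n → ℕ} → (∀ k → f k ≡ g k) → sumF n f ≡ sumF n g
  sumF-cong zero e = refl
  sumF-cong (suc n) e = cong₂ _+_ (e Fin.zero) (sumF-cong n (e ∘ Fin.suc))

  sumF-distribʳ : ∀ n (f : Fin n → ℕ) c → sumF n (λ k → f k * c) ≡ sumF n f * c
  sumF-distribʳ zero f c = refl
  sumF-distribʳ (suc n) f c =
    trans (cong (f Fin.zero * c +_) (sumF-distribʳ n (f ∘ Fin.suc) c)) (sym (*-distribʳ-+ c (f Fin.zero) _))

  sumF-distribˡ : ∀ n (f : Fin n → ℕ) c → sumF n (λ k → c * f k) ≡ c * sumF n f
  sumF-distribˡ n f c =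
    trans (sumF-cong n (λ k → *-comm c (f k))) (trans (sumF-distribʳ n f c) (*-comm _ c))

  prodF-cong : ∀ n {f g : Fin n → ℕ} → (∀ k → f k ≡ g k) → prodF n f ≡ prodF n g
  prodF-cong zero e = refl
  prodF-cong (suc n) e = cong₂ _*_ (e Fin.zero) (prodF-cong n (e ∘ Fin.suc))

  -- A vector v : Vec ℕ L lists block multiplicities: v[k] blocks of size suc (f k).
  -- Bell polynomials use f = toℕ; a general f is what lets the lemmas recurse on v.
  blockCount : ∀ {L} → Vec ℕ L → ℕ
  blockCount {L} v = sumF L (lookup v)

  weight : ∀ {L} → (Fin L → ℕ) → Vec ℕ L → ℕ
  weight {L} f v = sumF L (λ k → suc (f k) * lookup v k)

  denominator : ∀ {L} → (Fin L → ℕ) → Vec ℕ L → ℕ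
  denominator {L} f v = prodF L (λ k → fact (lookup v k) * fact (suc (f k)) ^ lookup v k)

  addBlock : ∀ {L} → Fin L → Vec ℕ L → Vec ℕ L
  addBlock k v = v [ k ]%= suc

  removeBlock : ∀ {L} → Fin L → Vec ℕ L → Vec ℕ L
  removeBlock k v = v [ k ]%= pred

  lookup-addBlock : ∀ {L} (k : Fin L) v → lookup (addBlock k v) k ≡ suc (lookup v k)
  lookup-addBlock k v = lookup∘updateAt k v

  removeBlock-addBlock : ∀ {L} (k : Fin L) v → removeBlock k (addBlock k v) ≡ v
  removeBlock-addBlock k v = trans (updateAt-updateAt k v) (updateAt-id k v)

  addBlock-removeBlock : ∀ {L} (k : Fin L) v {t} → lookup v k ≡ suc t → addBlock k (removeBlock k v) ≡ v
  addBlock-removeBlock k v e =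
    trans (updateAt-updateAt k v) (updateAt-id-local k v (trans (cong (suc ∘ pred) e) (sym e)))

  blockCount-addBlock : ∀ {L} (k : Fin L) v → blockCount (addBlock k v) ≡ suc (blockCount v)
  blockCount-addBlock Fin.zero (x ∷ v) = refl
  blockCount-addBlock (Fin.suc k) (x ∷ v) = trans (cong (x +_) (blockCount-addBlock k v)) (+-suc x _)

  weight-addBlock : ∀ {L} (f : Fin L → ℕ) k v → weight f (addBlock k v) ≡ suc (f k) + weight f v
  weight-addBlock f Fin.zero (x ∷ v) = lemma (f Fin.zero) x (weight (f ∘ Fin.suc) v)
    where lemma : ∀ a x w → suc a * suc x + w ≡ suc a + (suc a * x + w)
          lemma = solve-∀
  weight-addBlock f (Fin.suc k) (x ∷ v) =
    trans (cong (suc (f Fin.zero) * x +_) (weight-addBlock (f ∘ Fin.suc) k v))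
          (+-comm-middle (suc (f Fin.zero) * x) (suc (f (Fin.suc k))) (weight (f ∘ Fin.suc) v))
    where +-comm-middle : ∀ a b w → a + (b + w) ≡ b + (a + w)
          +-comm-middle = solve-∀

  denominator-addBlock : ∀ {L} (f : Fin L → ℕ) k v →
    denominator f (addBlock k v) ≡ denominator f v * (suc (lookup v k) * fact (suc (f k)))
  denominator-addBlock f Fin.zero (x ∷ v) =
    lemma (fact x) (fact (suc (f Fin.zero))) (fact (suc (f Fin.zero)) ^ x) (denominator (f ∘ Fin.suc) v) (suc x)
    where lemma : ∀ a b c p s → (s * a * (b * c)) * p ≡ (a * c) * p * (s * b)
          lemma = solve-∀
  denominator-addBlock f (Fin.suc k) (x ∷ v) =
    trans (cong (fact x * fact (suc (f Fin.zero)) ^ x *_) (denominator-addBlock (f ∘ Fin.suc) k v))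
          (sym (*-assoc (fact x * fact (suc (f Fin.zero)) ^ x) (denominator (f ∘ Fin.suc) v) _))

  lookup≤weight : ∀ {L} (f : Fin L → ℕ) k (v : Vec ℕ L) → lookup v k ≤ weight f v
  lookup≤weight f Fin.zero (x ∷ v) = ≤-trans (m≤n*m x (suc (f Fin.zero))) (m≤m+n _ _)
  lookup≤weight f (Fin.suc k) (x ∷ v) = ≤-trans (lookup≤weight (f ∘ Fin.suc) k v) (m≤n+m _ _)

  blockCount≤weight : ∀ {L} (f : Fin L → ℕ) v → blockCount v ≤ weight f v
  blockCount≤weight f [] = z≤n
  blockCount≤weight f (x ∷ v) = +-mono-≤ (m≤n*m x (suc (f Fin.zero))) (blockCount≤weight (f ∘ Fin.suc) v)

  blockCount≡0⇒weight≡0 : ∀ {L} (f : Fin L → ℕ) v → blockCount v ≡ 0 → weight f v ≡ 0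
  blockCount≡0⇒weight≡0 f [] e = refl
  blockCount≡0⇒weight≡0 f (zero ∷ v) e =
    trans (cong (_+ weight (f ∘ Fin.suc) v) (*-zeroʳ (suc (f Fin.zero))))
          (blockCount≡0⇒weight≡0 (f ∘ Fin.suc) v e)

  weight≡0⇒denominator≡1 : ∀ {L} (f : Fin L → ℕ) v → weight f v ≡ 0 → denominator f v ≡ 1
  weight≡0⇒denominator≡1 f [] e = refl
  weight≡0⇒denominator≡1 f (zero ∷ v) e =
    trans (+-identityʳ _) (weight≡0⇒denominator≡1 (f ∘ Fin.suc) v
      (trans (sym (cong (_+ weight (f ∘ Fin.suc) v) (*-zeroʳ (suc (f Fin.zero))))) e))

  denominator-nonZero : ∀ {L} (f : Fin L → ℕ) v → NonZero (denominator f v)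
  denominator-nonZero f [] = _
  denominator-nonZero f (x ∷ v) =
    m*n≢0 (fact x * fact (suc (f Fin.zero)) ^ x) (denominator (f ∘ Fin.suc) v)
      {{m*n≢0 (fact x) (fact (suc (f Fin.zero)) ^ x)
         {{fact-nonZero x}} {{m^n≢0 (fact (suc (f Fin.zero))) x {{fact-nonZero (suc (f Fin.zero))}}}}}}
      {{denominator-nonZero (f ∘ Fin.suc) v}}

  weight-cong : ∀ {L} {f g : Fin L → ℕ} → (∀ k → f k ≡ g k) → ∀ v → weight f v ≡ weight g v
  weight-cong {L} e v = sumF-cong L (λ k → cong (λ z → suc z * lookup v k) (e k))

  denominator-cong : ∀ {L} {f g : Fin L → ℕ} → (∀ k → f k ≡ g k) → ∀ v →
    denominator f v ≡ denominator g v
  denominator-cong {L} e v =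
    prodF-cong L (λ k → cong (λ z → fact (lookup v k) * fact (suc z) ^ lookup v k) (e k))

  blockCount-∷ʳ : ∀ {L} (v : Vec ℕ L) x → blockCount (v ∷ʳ x) ≡ blockCount v + x
  blockCount-∷ʳ [] x = +-identityʳ x
  blockCount-∷ʳ (y ∷ v) x = trans (cong (y +_) (blockCount-∷ʳ v x)) (sym (+-assoc y _ x))

  weight-∷ʳ : ∀ {L} (f : Fin (suc L) → ℕ) (v : Vec ℕ L) x →
    weight f (v ∷ʳ x) ≡ weight (f ∘ inject₁) v + suc (f (Fin.fromℕ L)) * x
  weight-∷ʳ f [] x = +-identityʳ _
  weight-∷ʳ f (y ∷ v) x =
    trans (cong (suc (f Fin.zero) * y +_) (weight-∷ʳ (f ∘ Fin.suc) v x))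
          (sym (+-assoc (suc (f Fin.zero) * y) (weight (f ∘ inject₁ ∘ Fin.suc) v) _))

  denominator-∷ʳ0 : ∀ {L} (f : Fin (suc L) → ℕ) (v : Vec ℕ L) →
    denominator f (v ∷ʳ 0) ≡ denominator (f ∘ inject₁) v
  denominator-∷ʳ0 f [] = refl
  denominator-∷ʳ0 f (y ∷ v) =
    cong (fact y * fact (suc (f Fin.zero)) ^ y *_) (denominator-∷ʳ0 (f ∘ Fin.suc) v)

  weight-∷ʳ0 : ∀ {L} (v : Vec ℕ L) → weight toℕ (v ∷ʳ 0) ≡ weight toℕ v
  weight-∷ʳ0 {L} v = begin
      weight toℕ (v ∷ʳ 0)
    ≡⟨ weight-∷ʳ toℕ v 0 ⟩
      weight (toℕ ∘ inject₁) v + suc (toℕ (Fin.fromℕ L)) * 0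
    ≡⟨ cong (weight (toℕ ∘ inject₁) v +_) (*-zeroʳ (suc (toℕ (Fin.fromℕ L)))) ⟩
      weight (toℕ ∘ inject₁) v + 0
    ≡⟨ +-identityʳ _ ⟩
      weight (toℕ ∘ inject₁) v
    ≡⟨ weight-cong toℕ-inject₁ v ⟩
      weight toℕ v
    ∎
    where open ≡-Reasoning

  length<weight-∷ʳ-suc : ∀ {L} (v : Vec ℕ L) x → L < weight toℕ (v ∷ʳ suc x)
  length<weight-∷ʳ-suc {L} v x = begin-strict
      L
    <⟨ s≤s (≤-reflexive (sym (toℕ-fromℕ L))) ⟩
      suc (toℕ (Fin.fromℕ L))
    ≤⟨ m≤m*n (suc (toℕ (Fin.fromℕ L))) (suc x) ⟩
      suc (toℕ (Fin.fromℕ L)) * suc x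
    ≤⟨ m≤n+m _ (weight (toℕ ∘ inject₁) v) ⟩
      weight (toℕ ∘ inject₁) v + suc (toℕ (Fin.fromℕ L)) * suc x
    ≡⟨ sym (weight-∷ʳ toℕ v (suc x)) ⟩
      weight toℕ (v ∷ʳ suc x)
    ∎
    where open ≤-Reasoning

  denominator-∷ʳ0′ : ∀ {L} (v : Vec ℕ L) → denominator toℕ (v ∷ʳ 0) ≡ denominator toℕ v
  denominator-∷ʳ0′ v = trans (denominator-∷ʳ0 toℕ v) (denominator-cong toℕ-inject₁ v)

  admissible : ∀ {L} → ℕ → ℕ → Vec ℕ L → Bool
  admissible n h v = (blockCount v ≡ᵇ h) ∧ (weight toℕ v ≡ᵇ n)

  admissible-sound : ∀ {L} {n h} (v : Vec ℕ L) → admissible n h v ≡ true →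
    blockCount v ≡ h × weight toℕ v ≡ n
  admissible-sound v e = ≡ᵇ-sound (∧-conicalˡ _ _ e) , ≡ᵇ-sound (∧-conicalʳ _ _ e)
    where ≡ᵇ-sound : ∀ {m n} → (m ≡ᵇ n) ≡ true → m ≡ n
          ≡ᵇ-sound {m} {n} e = ≡ᵇ⇒≡ m n (subst T (sym e) _)

  admissible-∷ʳ0 : ∀ {L} n h (v : Vec ℕ L) → admissible n h (v ∷ʳ 0) ≡ admissible n h v
  admissible-∷ʳ0 n h v =
    cong₂ (λ b w → (b ≡ᵇ h) ∧ (w ≡ᵇ n))
          (trans (blockCount-∷ʳ v 0) (+-identityʳ _)) (weight-∷ʳ0 v)

  +-≡ᵇ-∸ : ∀ m n w → m ≤ n → (m + w ≡ᵇ n) ≡ (w ≡ᵇ n ∸ m)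
  +-≡ᵇ-∸ zero n w _ = refl
  +-≡ᵇ-∸ (suc m) (suc n) w (s≤s m≤n) = +-≡ᵇ-∸ m n w m≤n

  admissible-addBlock : ∀ {L} n h (m : Fin L) v → toℕ m ≤ n →
    admissible (suc n) (suc h) (addBlock m v) ≡ admissible (n ∸ toℕ m) h v
  admissible-addBlock n h m v m≤n =
    trans (cong₂ (λ b w → (b ≡ᵇ suc h) ∧ (w ≡ᵇ suc n))
                 (blockCount-addBlock m v) (weight-addBlock toℕ m v))
          (cong ((blockCount v ≡ᵇ h) ∧_) (+-≡ᵇ-∸ (toℕ m) n (weight toℕ v) m≤n))

  -- The number of set partitions of a w-set with block multiplicities v (when weight toℕ v ≡ w).
  partitionCoeff : ∀ {L} → ℕ → Vec ℕ L → ℕ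
  partitionCoeff w v = divℕ (fact w) (denominator toℕ v)

  -- Partitions of {0,…,w} whose block containing w has size suc m: choose its other m elements.
  removalTerm : ∀ {L} → ℕ → Vec ℕ L → Fin L → ℕ
  removalTerm w v m =
    if 1 ≤ᵇ lookup v m then (w C toℕ m) * partitionCoeff (w ∸ toℕ m) (removeBlock m v) else 0

  removalTerm-addBlock : ∀ {L} w (m : Fin L) v →
    removalTerm w (addBlock m v) m ≡ (w C toℕ m) * partitionCoeff (w ∸ toℕ m) v
  removalTerm-addBlock w m v rewrite lookup-addBlock m v | removeBlock-addBlock m v = refl

  PartitionCoeffSpec : ℕ → Set
  PartitionCoeffSpec w =
    ∀ {L} (v : Vec ℕ L) → weight toℕ v ≡ w → partitionCoeff w v * denominator toℕ v ≡ fact w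

  module _ {w} (spec : ∀ {w′} → w′ < suc w → PartitionCoeffSpec w′) where

    denominator*removalTerm-addBlock : ∀ {L} (m : Fin L) u → weight toℕ (addBlock m u) ≡ suc w →
      denominator toℕ (addBlock m u) * removalTerm w (addBlock m u) m
      ≡ suc (toℕ m) * lookup (addBlock m u) m * fact w
    denominator*removalTerm-addBlock m u e
      rewrite lookup-addBlock m u | removeBlock-addBlock m u | denominator-addBlock toℕ m u = begin
        d * (s * fact (suc i)) * ((w C i) * partitionCoeff (w ∸ i) u)
      ≡⟨ rearrange d s i (fact i) (w C i) (partitionCoeff (w ∸ i) u) ⟩
        suc i * s * ((w C i) * (fact i * (partitionCoeff (w ∸ i) u * d)))
      ≡⟨ cong (λ z → suc i * s * ((w C i) * (fact i * z))) (spec (s≤s (m∸n≤m w i)) u weight-u) ⟩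
        suc i * s * ((w C i) * (fact i * fact (w ∸ i)))
      ≡⟨ cong (suc i * s *_) (C*fact*fact≡fact i≤w) ⟩
        suc i * s * fact w
      ∎
      where
      open ≡-Reasoning
      i s d : ℕ
      i = toℕ m
      s = suc (lookup u m)
      d = denominator toℕ u
      rearrange : ∀ d s i fi c q → d * (s * (fi + i * fi)) * (c * q) ≡ suc i * s * (c * (fi * (q * d)))
      rearrange = solve-∀
      weight-split : suc i + weight toℕ u ≡ suc w
      weight-split = trans (sym (weight-addBlock toℕ m u)) e
      i≤w : i ≤ w
      i≤w = ≤-pred (≤-trans (m≤m+n (suc i) (weight toℕ u)) (≤-reflexive weight-split))
      weight-u : weight toℕ u ≡ w ∸ i
      weight-u = trans (sym (m+n∸m≡n i (weight toℕ u))) (cong (_∸ i) (suc-injective weight-split))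

    denominator*removalTerm : ∀ {L} (m : Fin L) v → weight toℕ v ≡ suc w →
      denominator toℕ v * removalTerm w v m ≡ suc (toℕ m) * lookup v m * fact w
    denominator*removalTerm m v e = byMultiplicity (lookup v m) refl
      where
      byMultiplicity : ∀ x → lookup v m ≡ x →
        denominator toℕ v * removalTerm w v m ≡ suc (toℕ m) * lookup v m * fact w
      byMultiplicity zero eq rewrite eq =
        trans (*-zeroʳ (denominator toℕ v)) (sym (cong (_* fact w) (*-zeroʳ (suc (toℕ m)))))
      byMultiplicity (suc t) eq =
        subst (λ u → denominator toℕ u * removalTerm w u m ≡ suc (toℕ m) * lookup u m * fact w) v≡
          (denominator*removalTerm-addBlock m (removeBlock m v) (trans (cong (weight toℕ) v≡) e))
        where v≡ : addBlock m (removeBlock m v) ≡ v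
              v≡ = addBlock-removeBlock m v eq

    denominator*removalSum : ∀ {L} (v : Vec ℕ L) → weight toℕ v ≡ suc w →
      denominator toℕ v * sumF L (removalTerm w v) ≡ fact (suc w)
    denominator*removalSum {L} v e = begin
        denominator toℕ v * sumF L (removalTerm w v)
      ≡⟨ sym (sumF-distribˡ L (removalTerm w v) (denominator toℕ v)) ⟩
        sumF L (λ m → denominator toℕ v * removalTerm w v m)
      ≡⟨ sumF-cong L (λ m → denominator*removalTerm m v e) ⟩
        sumF L (λ m → suc (toℕ m) * lookup v m * fact w)
      ≡⟨ sumF-distribʳ L (λ m → suc (toℕ m) * lookup v m) (fact w) ⟩
        weight toℕ v * fact w
      ≡⟨ cong (_* fact w) e ⟩
        fact (suc w)
      ∎
      where open ≡-Reasoning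

    partitionCoeff-removal : ∀ {L} (v : Vec ℕ L) → weight toℕ v ≡ suc w →
      partitionCoeff (suc w) v ≡ sumF L (removalTerm w v)
    partitionCoeff-removal {L} v e =
      trans (cong (λ z → divℕ z (denominator toℕ v))
                  (trans (sym (denominator*removalSum v e)) (*-comm (denominator toℕ v) _)))
            (divℕ-*-cancelʳ (sumF L (removalTerm w v)) (denominator toℕ v) {{denominator-nonZero toℕ v}})

  partitionCoeff*denominator : ∀ w → PartitionCoeffSpec w
  partitionCoeff*denominator = <-rec PartitionCoeffSpec step
    where
    step : ∀ w → (∀ {w′} → w′ < w → PartitionCoeffSpec w′) → PartitionCoeffSpec w
    step zero _ v e rewrite weight≡0⇒denominator≡1 toℕ v e = refl
    step (suc w) spec v e =
      trans (cong (_* denominator toℕ v) (partitionCoeff-removal spec v e))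
            (trans (*-comm _ (denominator toℕ v)) (denominator*removalSum spec v e))

  partitionCoeff-recurrence : ∀ w {L} (v : Vec ℕ L) → weight toℕ v ≡ suc w →
    partitionCoeff (suc w) v ≡ sumF L (removalTerm w v)
  partitionCoeff-recurrence w = partitionCoeff-removal (λ _ → partitionCoeff*denominator _)

module FiniteSums {c ℓ : Level} (R : CommutativeRing c ℓ) where
  open import Data.Nat as ℕ using (ℕ; zero; suc; _≤_; _<_; z≤n; s≤s)
  import Data.Nat.Properties as ℕ
  open import Data.Fin as Fin using (Fin; toℕ)
  import Data.Fin.Properties as Fin
  open import Data.Fin.Permutation using (reverse)
  open import Data.Vec using (Vec; []; _∷_; _∷ʳ_)
  open import Data.List as List using (List; []; _∷_; map; applyUpTo; upTo; concatMap; filterᵇ; _++_)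
  import Data.List.Properties as List
  open import Data.Bool using (Bool; true; false; if_then_else_)
  open import Function using (_∘_)
  open import Relation.Binary.PropositionalEquality as ≡ using (_≡_)
  open CommutativeRing R
  open Hurwitz R
  open import Algebra.Properties.Semiring.Sum semiring public
  open import Relation.Binary.Reasoning.Setoid setoid

  sum-zero : ∀ {n} {f : Fin n → Carrier} → (∀ i → f i ≈ 0#) → sum f ≈ 0#
  sum-zero {n} e = trans (sum-cong-≋ e) (sum-replicate-zero n)

  sumℕ : ℕ → (ℕ → Carrier) → Carrier
  sumℕ n f = ∑[ i < n ] f (toℕ i)

  sumR-map-applyUpTo : ∀ (g : ℕ → Carrier) f n → sumR (map g (applyUpTo f n)) ≡ sumℕ n (g ∘ f)
  sumR-map-applyUpTo g f zero = ≡.refl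
  sumR-map-applyUpTo g f (suc n) = ≡.cong (g (f 0) +_) (sumR-map-applyUpTo g (f ∘ suc) n)

  sumR-map-upTo : ∀ (g : ℕ → Carrier) n → sumR (map g (upTo n)) ≡ sumℕ n g
  sumR-map-upTo g = sumR-map-applyUpTo g (λ i → i)

  sumℕ-cong : ∀ n {f g : ℕ → Carrier} → (∀ i → i < n → f i ≈ g i) → sumℕ n f ≈ sumℕ n g
  sumℕ-cong n e = sum-cong-≋ {n} (λ i → e (toℕ i) (Fin.toℕ<n i))

  sumℕ-last : ∀ n (f : ℕ → Carrier) → sumℕ (suc n) f ≈ sumℕ n f + f n
  sumℕ-last n f = trans (sum-init-last {n} (f ∘ toℕ))
    (+-cong (reflexive (sum-cong-≗ {n} (≡.cong f ∘ Fin.toℕ-inject₁)))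
            (reflexive (≡.cong f (Fin.toℕ-fromℕ n))))

  sumℕ-reverse : ∀ n (f : ℕ → Carrier) → sumℕ (suc n) f ≈ sumℕ (suc n) (λ i → f (n ℕ.∸ i))
  sumℕ-reverse n f = trans (sum-permute {suc n} (f ∘ toℕ) reverse)
    (reflexive (sum-cong-≗ {suc n} (≡.cong f ∘ Fin.opposite-prop {suc n})))

  sumℕ-vanishing-tail : ∀ m n (f : ℕ → Carrier) → m ≤ n → (∀ i → m ≤ i → f i ≈ 0#) →
    sumℕ n f ≈ sumℕ m f
  sumℕ-vanishing-tail zero n f _ z = sum-zero {n} (λ i → z (toℕ i) z≤n)
  sumℕ-vanishing-tail (suc m) (suc n) f (s≤s m≤n) z =
    +-congˡ (sumℕ-vanishing-tail m n (f ∘ suc) m≤n (λ i m≤i → z (suc i) (s≤s m≤i)))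

  box : ℕ → (m : ℕ) → (Vec ℕ m → Carrier) → Carrier
  box b zero F = F []
  box b (suc m) F = sumℕ (suc b) (λ x → box b m (F ∘ (x ∷_)))

  box-cong : ∀ b m {F G : Vec ℕ m → Carrier} → (∀ v → F v ≈ G v) → box b m F ≈ box b m G
  box-cong b zero e = e []
  box-cong b (suc m) e = sum-cong-≋ {suc b} (λ x → box-cong b m (e ∘ (toℕ x ∷_)))

  box-zero : ∀ b m {F : Vec ℕ m → Carrier} → (∀ v → F v ≈ 0#) → box b m F ≈ 0#
  box-zero b zero e = e []
  box-zero b (suc m) e = sum-zero {suc b} (λ x → box-zero b m (e ∘ (toℕ x ∷_)))

  box-distrib-+ : ∀ b m (F G : Vec ℕ m → Carrier) → box b m (λ v → F v + G v) ≈ box b m F + box b m G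
  box-distrib-+ b zero F G = refl
  box-distrib-+ b (suc m) F G =
    trans (sum-cong-≋ {suc b} (λ x → box-distrib-+ b m (F ∘ (toℕ x ∷_)) (G ∘ (toℕ x ∷_))))
          (∑-distrib-+ {suc b} (λ x → box b m (F ∘ (toℕ x ∷_))) (λ x → box b m (G ∘ (toℕ x ∷_))))

  *-distribˡ-box : ∀ b m a (F : Vec ℕ m → Carrier) → a * box b m F ≈ box b m (λ v → a * F v)
  *-distribˡ-box b zero a F = refl
  *-distribˡ-box b (suc m) a F =
    trans (*-distribˡ-sum {suc b} a (λ x → box b m (F ∘ (toℕ x ∷_))))
          (sum-cong-≋ {suc b} (λ x → *-distribˡ-box b m a (F ∘ (toℕ x ∷_))))

  *-distribʳ-box : ∀ b m a (F : Vec ℕ m → Carrier) → box b m F * a ≈ box b m (λ v → F v * a)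
  *-distribʳ-box b zero a F = refl
  *-distribʳ-box b (suc m) a F =
    trans (*-distribʳ-sum {suc b} a (λ x → box b m (F ∘ (toℕ x ∷_))))
          (sum-cong-≋ {suc b} (λ x → *-distribʳ-box b m a (F ∘ (toℕ x ∷_))))

  sum-box : ∀ {n} b m (G : Fin n → Vec ℕ m → Carrier) →
    ∑[ k < n ] box b m (G k) ≈ box b m (λ v → ∑[ k < n ] G k v)
  sum-box {zero} b m G = sym (box-zero b m (λ _ → refl))
  sum-box {suc n} b m G =
    trans (+-congˡ (sum-box b m (G ∘ Fin.suc))) (sym (box-distrib-+ b m (G Fin.zero) _))

  box-∷ʳ : ∀ b m (F : Vec ℕ (suc m) → Carrier) →
    box b (suc m) F ≈ box b m (λ v → sumℕ (suc b) (λ x → F (v ∷ʳ x)))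
  box-∷ʳ b zero F = refl
  box-∷ʳ b (suc m) F = sum-cong-≋ {suc b} (λ x → box-∷ʳ b m (F ∘ (toℕ x ∷_)))

  sumR-++ : ∀ xs ys → sumR (xs ++ ys) ≈ sumR xs + sumR ys
  sumR-++ [] ys = sym (+-identityˡ _)
  sumR-++ (x ∷ xs) ys = trans (+-congˡ (sumR-++ xs ys)) (sym (+-assoc x (sumR xs) (sumR ys)))

  sumR-map-concatMap : ∀ {A B : Set} (F : B → Carrier) (g : A → List B) xs →
    sumR (map F (concatMap g xs)) ≈ sumR (map (λ x → sumR (map F (g x))) xs)
  sumR-map-concatMap F g [] = refl
  sumR-map-concatMap F g (x ∷ xs) =
    trans (reflexive (≡.cong sumR (List.map-++ F (g x) (concatMap g xs))))
          (trans (sumR-++ (map F (g x)) _) (+-congˡ (sumR-map-concatMap F g xs)))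

  sumR-map-filterᵇ : ∀ {A : Set} (p : A → Bool) (F : A → Carrier) xs →
    sumR (map F (filterᵇ p xs)) ≈ sumR (map (λ x → if p x then F x else 0#) xs)
  sumR-map-filterᵇ p F [] = refl
  sumR-map-filterᵇ p F (x ∷ xs) with p x
  ... | true = +-congˡ (sumR-map-filterᵇ p F xs)
  ... | false = trans (sumR-map-filterᵇ p F xs) (sym (+-identityˡ _))

  sumR-map-vecsBelow : ∀ b m (F : Vec ℕ m → Carrier) → sumR (map F (vecsBelow b m)) ≈ box b m F
  sumR-map-vecsBelow b zero F = +-identityʳ _
  sumR-map-vecsBelow b (suc m) F = begin
      sumR (map F (concatMap (λ x → map (x ∷_) (vecsBelow b m)) (upTo (suc b))))
    ≈⟨ sumR-map-concatMap F (λ x → map (x ∷_) (vecsBelow b m)) (upTo (suc b)) ⟩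
      sumR (map (λ x → sumR (map F (map (x ∷_) (vecsBelow b m)))) (upTo (suc b)))
    ≡⟨ sumR-map-upTo _ (suc b) ⟩
      sumℕ (suc b) (λ x → sumR (map F (map (x ∷_) (vecsBelow b m))))
    ≈⟨ sum-cong-≋ {suc b} (λ x →
         trans (reflexive (≡.cong sumR (≡.sym (List.map-∘ {g = F} {f = toℕ x ∷_} (vecsBelow b m)))))
               (sumR-map-vecsBelow b m (F ∘ (toℕ x ∷_)))) ⟩
      box b (suc m) F
    ∎

  fromℕ-+ : ∀ m n → fromℕ (m ℕ.+ n) ≈ fromℕ m + fromℕ n
  fromℕ-+ zero n = sym (+-identityˡ _)
  fromℕ-+ (suc m) n = trans (+-congˡ (fromℕ-+ m n)) (sym (+-assoc 1# (fromℕ m) (fromℕ n)))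

  fromℕ-* : ∀ m n → fromℕ (m ℕ.* n) ≈ fromℕ m * fromℕ n
  fromℕ-* zero n = sym (zeroˡ _)
  fromℕ-* (suc m) n =
    trans (fromℕ-+ n (m ℕ.* n))
          (trans (+-cong (sym (*-identityˡ (fromℕ n))) (fromℕ-* m n))
                 (sym (distribʳ (fromℕ n) 1# (fromℕ m))))

  fromℕ-sumF : ∀ n (f : Fin n → ℕ) → fromℕ (sumF n f) ≈ ∑[ k < n ] fromℕ (f k)
  fromℕ-sumF zero f = refl
  fromℕ-sumF (suc n) f = trans (fromℕ-+ (f Fin.zero) _) (+-congˡ (fromℕ-sumF n (f ∘ Fin.suc)))

module BellPolynomials {c ℓ : Level} (R : CommutativeRing c ℓ) (y : Hurwitz.Seq R) where
  open import Data.Nat as ℕ using (ℕ; zero; suc; _≤_; _<_; _≤′_; ≤′-refl; ≤′-step)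
  import Data.Nat.Properties as ℕ
  open import Data.Nat.Combinatorics using (_C_; nCk≡nC[n∸k])
  open import Data.Fin as Fin using (Fin; toℕ)
  import Data.Fin.Properties as Fin
  open import Data.Vec using (Vec; []; _∷_; lookup; _∷ʳ_)
  open import Data.Bool using (Bool; true; false; if_then_else_)
  open import Data.Empty using (⊥; ⊥-elim)
  open import Data.Product using (_,_; proj₂)
  open import Function using (_∘_)
  open import Relation.Binary.PropositionalEquality as ≡ using (_≡_)
  open CommutativeRing R
  open import Algebra.Properties.CommutativeSemigroup *-commutativeSemigroup using (x∙yz≈y∙xz; xy∙z≈x∙zy)
  open Hurwitz R
  open FiniteSums R
  open BlockMultiplicities
  open import Relation.Binary.Reasoning.Setoid setoid

  monomial : ∀ {L} → (Fin L → ℕ) → Vec ℕ L → Carrier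
  monomial {L} f v = prodFR L (λ k → pow (y (suc (f k))) (lookup v k))

  monomial-addBlock : ∀ {L} (f : Fin L → ℕ) k v → monomial f (addBlock k v) ≈ y (suc (f k)) * monomial f v
  monomial-addBlock f Fin.zero (x ∷ v) = *-assoc _ _ _
  monomial-addBlock f (Fin.suc k) (x ∷ v) =
    trans (*-congˡ (monomial-addBlock (f ∘ Fin.suc) k v)) (x∙yz≈y∙xz _ _ _)

  monomial-∷ʳ0 : ∀ {L} (f : Fin (suc L) → ℕ) (g : Fin L → ℕ) (v : Vec ℕ L) →
    (∀ k → f (Fin.inject₁ k) ≡ g k) → monomial f (v ∷ʳ 0) ≈ monomial g v
  monomial-∷ʳ0 f g [] _ = *-identityʳ 1#
  monomial-∷ʳ0 f g (x ∷ v) e =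
    *-cong (reflexive (≡.cong (λ z → pow (y (suc z)) x) (e Fin.zero)))
           (monomial-∷ʳ0 (f ∘ Fin.suc) (g ∘ Fin.suc) v (e ∘ Fin.suc))

  if-false : ∀ (b : Bool) {x} → (b ≡ true → ⊥) → (if b then x else 0#) ≈ 0#
  if-false false _ = refl
  if-false true ¬b = ⊥-elim (¬b ≡.refl)

  bellSummand : ∀ {L} → ℕ → ℕ → Vec ℕ L → Carrier
  bellSummand n h v = if admissible n h v then fromℕ (partitionCoeff n v) * monomial toℕ v else 0#

  bellSummand-vanishes : ∀ {L} {n h} (v : Vec ℕ L) → (blockCount v ≡ h → weight toℕ v ≡ n → ⊥) →
    bellSummand n h v ≈ 0#
  bellSummand-vanishes {n = n} {h} v ¬adm =
    if-false (admissible n h v) (λ e → let (bc , w) = admissible-sound v e in ¬adm bc w)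

  bellSummand-heavy : ∀ {L} {n} h (v : Vec ℕ L) → n < weight toℕ v → bellSummand n h v ≈ 0#
  bellSummand-heavy h v n<w = bellSummand-vanishes v (λ _ w≡n → ℕ.<-irrefl (≡.sym w≡n) n<w)

  bellSummand-∷ʳ0 : ∀ {L} n h (v : Vec ℕ L) → bellSummand n h (v ∷ʳ 0) ≈ bellSummand n h v
  bellSummand-∷ʳ0 n h v rewrite admissible-∷ʳ0 n h v | denominator-∷ʳ0′ v with admissible n h v
  ... | true = *-congˡ (monomial-∷ʳ0 toℕ toℕ v Fin.toℕ-inject₁)
  ... | false = refl

  Bell≈box : ∀ n h → Bell n h y ≈ box n n (bellSummand n h)
  Bell≈box zero zero = sym (trans (*-identityʳ _) (+-identityʳ 1#))
  Bell≈box zero (suc h) = refl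
  Bell≈box (suc n) zero = sym (box-zero (suc n) (suc n) (λ v → bellSummand-vanishes {n = suc n} {h = 0} v
    (λ bc≡0 w≡n → ℕ.1+n≢0 (≡.trans (≡.sym w≡n) (blockCount≡0⇒weight≡0 toℕ v bc≡0)))))
  Bell≈box (suc n) (suc h) =
    trans (sumR-map-filterᵇ (admissible (suc n) (suc h)) _ (vecsBelow (suc n) (suc n)))
          (sumR-map-vecsBelow (suc n) (suc n) (bellSummand (suc n) (suc h)))

  Bell-vanishes : ∀ n h → n < h → Bell n h y ≈ 0#
  Bell-vanishes n h n<h = trans (Bell≈box n h) (box-zero n n (λ v → bellSummand-vanishes {n = n} {h = h} v
    (λ bc≡h w≡n → ℕ.<-irrefl ≡.refl
      (ℕ.<-≤-trans n<h (≡.subst₂ _≤_ bc≡h w≡n (blockCount≤weight toℕ v))))))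

  box-bellSummand-length-suc : ∀ b {n L} h → n ≤ L → box b L (bellSummand n h) ≈ box b (suc L) (bellSummand n h)
  box-bellSummand-length-suc b {n} {L} h n≤L = sym (trans (box-∷ʳ b L (bellSummand n h)) (box-cong b L lastZero))
    where
    lastZero : ∀ v → sumℕ (suc b) (λ x → bellSummand n h (v ∷ʳ x)) ≈ bellSummand n h v
    lastZero v = begin
        bellSummand n h (v ∷ʳ 0) + sumℕ b (λ x → bellSummand n h (v ∷ʳ suc x))
      ≈⟨ +-cong (bellSummand-∷ʳ0 n h v)
                (sum-zero {b} (λ x → bellSummand-heavy h (v ∷ʳ suc (toℕ x))
                  (ℕ.≤-<-trans n≤L (length<weight-∷ʳ-suc v (toℕ x))))) ⟩
        bellSummand n h v + 0#
      ≈⟨ +-identityʳ _ ⟩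
        bellSummand n h v
      ∎

  box-bound-suc : ∀ b L (F : Vec ℕ L → Carrier) → (∀ v k → b < lookup v k → F v ≈ 0#) →
    box b L F ≈ box (suc b) L F
  box-bound-suc b zero F z = refl
  box-bound-suc b (suc L) F z = sym (begin
      sumℕ (suc (suc b)) G
    ≈⟨ sumℕ-last (suc b) G ⟩
      sumℕ (suc b) G + G (suc b)
    ≈⟨ +-cong (sum-cong-≋ {suc b} (λ x →
                 sym (box-bound-suc b L (F ∘ (toℕ x ∷_)) (λ v k → z (toℕ x ∷ v) (Fin.suc k)))))
              (box-zero (suc b) L (λ v → z (suc b ∷ v) Fin.zero (ℕ.n<1+n b))) ⟩
      box b (suc L) F + 0#
    ≈⟨ +-identityʳ _ ⟩
      box b (suc L) F
    ∎)
    where G : ℕ → Carrier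
          G x = box (suc b) L (F ∘ (x ∷_))

  Bell≈enlargedBox : ∀ {n b L} h → n ≤ b → n ≤ L → Bell n h y ≈ box b L (bellSummand n h)
  Bell≈enlargedBox {n} {L = L} h n≤b n≤L =
    trans (Bell≈box n h) (trans (lengthen (ℕ.≤⇒≤′ n≤L)) (widen {L = L} (ℕ.≤⇒≤′ n≤b)))
    where
    lengthen : ∀ {L} → n ≤′ L → box n n (bellSummand n h) ≈ box n L (bellSummand n h)
    lengthen ≤′-refl = refl
    lengthen (≤′-step n≤L) = trans (lengthen n≤L) (box-bellSummand-length-suc n h (ℕ.≤′⇒≤ n≤L))
    widen : ∀ {b L} → n ≤′ b → box n L (bellSummand n h) ≈ box b L (bellSummand n h)
    widen ≤′-refl = refl
    widen {L = L} (≤′-step {b} n≤b) = trans (widen {L = L} n≤b) (box-bound-suc b L (bellSummand n h)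
      (λ v k b<v → bellSummand-heavy h v
        (ℕ.≤-<-trans (ℕ.≤′⇒≤ n≤b) (ℕ.<-≤-trans b<v (lookup≤weight toℕ k v)))))

  box-addBlock : ∀ b L (k : Fin L) (H : Vec ℕ L → Carrier) → (∀ v → lookup v k ≡ 0 → H v ≈ 0#) →
    (∀ v → lookup v k ≡ b → H (addBlock k v) ≈ 0#) → box b L (H ∘ addBlock k) ≈ box b L H
  box-addBlock b (suc L) Fin.zero H empty full = begin
      sumℕ (suc b) (G ∘ suc)
    ≈⟨ sumℕ-last b (G ∘ suc) ⟩
      sumℕ b (G ∘ suc) + G (suc b)
    ≈⟨ +-congˡ (box-zero b L (λ v → full (b ∷ v) ≡.refl)) ⟩
      sumℕ b (G ∘ suc) + 0#
    ≈⟨ +-comm _ _ ⟩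
      0# + sumℕ b (G ∘ suc)
    ≈⟨ +-congʳ (sym (box-zero b L (λ v → empty (0 ∷ v) ≡.refl))) ⟩
      G 0 + sumℕ b (G ∘ suc)
    ∎
    where G : ℕ → Carrier
          G x = box b L (H ∘ (x ∷_))
  box-addBlock b (suc L) (Fin.suc k) H empty full =
    sum-cong-≋ {suc b} (λ x →
      box-addBlock b L k (H ∘ (toℕ x ∷_)) (empty ∘ (toℕ x ∷_)) (full ∘ (toℕ x ∷_)))

  -- Summand of B_{n+1,h+1} attributed to the block of size suc m that contains the element n+1.
  removalSummand : ∀ {L} → ℕ → ℕ → Fin L → Vec ℕ L → Carrier
  removalSummand n h m u =
    fromℕ (removalTerm n u m) * (if admissible (suc n) (suc h) u then monomial toℕ u else 0#)

  sum-removalSummand : ∀ {L} n h (u : Vec ℕ L) →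
    ∑[ m < L ] removalSummand n h m u ≈ bellSummand (suc n) (suc h) u
  sum-removalSummand {L} n h u = begin
      ∑[ m < L ] removalSummand n h m u
    ≈⟨ sym (*-distribʳ-sum G (λ m → fromℕ (removalTerm n u m))) ⟩
      (∑[ m < L ] fromℕ (removalTerm n u m)) * G
    ≈⟨ *-congʳ (sym (fromℕ-sumF L (removalTerm n u))) ⟩
      fromℕ (sumF L (removalTerm n u)) * G
    ≈⟨ byAdmissibility ⟩
      bellSummand (suc n) (suc h) u
    ∎
    where
    G : Carrier
    G = if admissible (suc n) (suc h) u then monomial toℕ u else 0#
    byAdmissibility :
      fromℕ (sumF L (removalTerm n u)) * (if admissible (suc n) (suc h) u then monomial toℕ u else 0#)
      ≈ bellSummand (suc n) (suc h) u
    byAdmissibility with admissible (suc n) (suc h) u in adm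
    ... | true = *-congʳ (reflexive (≡.cong fromℕ
                   (≡.sym (partitionCoeff-recurrence n u (proj₂ (admissible-sound u adm))))))
    ... | false = zeroʳ _

  x∙[yz∙w]≈xy∙[wz] : ∀ x y z w → x * ((y * z) * w) ≈ (x * y) * (w * z)
  x∙[yz∙w]≈xy∙[wz] x y z w = trans (*-congˡ (xy∙z≈x∙zy y z w)) (sym (*-assoc x y (w * z)))

  removalSummand-addBlock : ∀ {L} n h (m : Fin L) v → toℕ m ≤ n →
    fromℕ (n C toℕ m) * (bellSummand (n ℕ.∸ toℕ m) h v * y (suc (toℕ m)))
    ≈ removalSummand n h m (addBlock m v)
  removalSummand-addBlock n h m v m≤n
    rewrite removalTerm-addBlock n m v | admissible-addBlock n h m v m≤n with admissible (n ℕ.∸ toℕ m) h v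
  ... | true = trans (x∙[yz∙w]≈xy∙[wz] _ _ _ _)
    (sym (*-cong (fromℕ-* (n C toℕ m) (partitionCoeff (n ℕ.∸ toℕ m) v)) (monomial-addBlock toℕ m v)))
  ... | false = trans (*-congˡ (zeroˡ _)) (trans (zeroʳ _) (sym (zeroʳ _)))

  removalSummand-empty : ∀ {L} n h (m : Fin L) v → lookup v m ≡ 0 → removalSummand n h m v ≈ 0#
  removalSummand-empty n h m v e rewrite e = zeroˡ _

  removalSummand-full : ∀ {L} n h (m : Fin L) v → lookup v m ≡ suc n →
    removalSummand n h m (addBlock m v) ≈ 0#
  removalSummand-full n h m v e =
    trans (*-congˡ (if-false (admissible (suc n) (suc h) (addBlock m v)) tooHeavy)) (zeroʳ _)
    where
    tooHeavy : admissible (suc n) (suc h) (addBlock m v) ≡ true → ⊥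
    tooHeavy adm = ℕ.1+n≰n (≡.subst₂ _≤_ (≡.trans (lookup-addBlock m v) (≡.cong suc e))
                                         (proj₂ (admissible-sound (addBlock m v) adm))
                                         (lookup≤weight toℕ m (addBlock m v)))

  box-removalSummand : ∀ n h (m : Fin (suc n)) → toℕ m ≤ n →
    fromℕ (n C toℕ m) * (box (suc n) (suc n) (bellSummand (n ℕ.∸ toℕ m) h) * y (suc (toℕ m)))
    ≈ box (suc n) (suc n) (removalSummand n h m)
  box-removalSummand n h m m≤n = begin
      fromℕ (n C toℕ m) * (box N N (bellSummand (n ℕ.∸ toℕ m) h) * y (suc (toℕ m)))
    ≈⟨ *-congˡ (*-distribʳ-box N N (y (suc (toℕ m))) (bellSummand (n ℕ.∸ toℕ m) h)) ⟩
      fromℕ (n C toℕ m) * box N N (λ v → bellSummand (n ℕ.∸ toℕ m) h v * y (suc (toℕ m)))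
    ≈⟨ *-distribˡ-box N N (fromℕ (n C toℕ m)) (λ v → bellSummand (n ℕ.∸ toℕ m) h v * y (suc (toℕ m))) ⟩
      box N N (λ v → fromℕ (n C toℕ m) * (bellSummand (n ℕ.∸ toℕ m) h v * y (suc (toℕ m))))
    ≈⟨ box-cong N N (λ v → removalSummand-addBlock n h m v m≤n) ⟩
      box N N (removalSummand n h m ∘ addBlock m)
    ≈⟨ box-addBlock N N m (removalSummand n h m) (removalSummand-empty n h m) (removalSummand-full n h m) ⟩
      box N N (removalSummand n h m)
    ∎
    where N : ℕ
          N = suc n

  Bell-recurrence : ∀ n h →
    Bell (suc n) (suc h) y ≈ sumℕ (suc n) (λ k → fromℕ (n C k) * (Bell k h y * y (suc (n ℕ.∸ k))))
  Bell-recurrence n h = sym (begin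
      sumℕ N (λ k → fromℕ (n C k) * (Bell k h y * y (suc (n ℕ.∸ k))))
    ≈⟨ sumℕ-reverse n (λ k → fromℕ (n C k) * (Bell k h y * y (suc (n ℕ.∸ k)))) ⟩
      sumℕ N (λ k → fromℕ (n C (n ℕ.∸ k)) * (Bell (n ℕ.∸ k) h y * y (suc (n ℕ.∸ (n ℕ.∸ k)))))
    ≈⟨ sumℕ-cong N (λ k k<N → inBox k (ℕ.≤-pred k<N)) ⟩
      ∑[ m < N ] (fromℕ (n C toℕ m) * (box N N (bellSummand (n ℕ.∸ toℕ m) h) * y (suc (toℕ m))))
    ≈⟨ sum-cong-≋ {N} (λ m → box-removalSummand n h m (ℕ.≤-pred (Fin.toℕ<n m))) ⟩
      ∑[ m < N ] box N N (removalSummand n h m)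
    ≈⟨ sum-box N N (removalSummand n h) ⟩
      box N N (λ v → ∑[ m < N ] removalSummand n h m v)
    ≈⟨ box-cong N N (sum-removalSummand n h) ⟩
      box N N (bellSummand N (suc h))
    ≈⟨ sym (Bell≈box N (suc h)) ⟩
      Bell N (suc h) y
    ∎)
    where
    N : ℕ
    N = suc n
    inBox : ∀ k → k ≤ n → fromℕ (n C (n ℕ.∸ k)) * (Bell (n ℕ.∸ k) h y * y (suc (n ℕ.∸ (n ℕ.∸ k))))
                          ≈ fromℕ (n C k) * (box N N (bellSummand (n ℕ.∸ k) h) * y (suc k))
    inBox k k≤n = *-cong (reflexive (≡.cong fromℕ (≡.sym (nCk≡nC[n∸k] k≤n))))
      (*-cong (Bell≈enlargedBox h n∸k≤N n∸k≤N) (reflexive (≡.cong (y ∘ suc) (ℕ.m∸[m∸n]≡n k≤n))))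
      where n∸k≤N : n ℕ.∸ k ≤ N
            n∸k≤N = ℕ.m≤n⇒m≤1+n (ℕ.m∸n≤m n k)

module HurwitzSeries {c ℓ : Level} (R : CommutativeRing c ℓ) where
  open import Data.Nat as ℕ using (ℕ; zero; suc; _≤_; _<_; s≤s)
  import Data.Nat.Properties as ℕ
  open import Data.Nat.Combinatorics using (_C_; nCn≡1)
  open import Data.Nat.Induction using (<-rec)
  open import Data.Product using (_,_)
  open import Data.Fin using (toℕ)
  open import Relation.Binary.PropositionalEquality as ≡ using (_≡_)
  open CommutativeRing R
  open import Algebra.Properties.Group +-group using (∙-cancelˡ)
  open import Algebra.Properties.CommutativeSemigroup *-commutativeSemigroup using (x∙yz≈y∙xz)
  open Hurwitz R
  open FiniteSums R
  open import Relation.Binary.Reasoning.Setoid setoid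

  ⋆-as-sum : ∀ a b n → (a ⋆ b) n ≡ sumℕ (suc n) (λ h → fromℕ (n C h) * (a h * b (n ℕ.∸ h)))
  ⋆-as-sum a b n = sumR-map-upTo (λ h → fromℕ (n C h) * (a h * b (n ℕ.∸ h))) (suc n)

  ∘ₕ-as-sum : ∀ a b n → (a ∘ₕ b) n ≡ sumℕ (suc n) (λ h → a h * Bell n h b)
  ∘ₕ-as-sum a b n = sumR-map-upTo (λ h → a h * Bell n h b) (suc n)

  ∘ₕ-as-longer-sum : ∀ a b {k n} → k ≤ n → (a ∘ₕ b) k ≈ sumℕ (suc n) (λ h → a h * Bell k h b)
  ∘ₕ-as-longer-sum a b {k} {n} k≤n = trans (reflexive (∘ₕ-as-sum a b k))
    (sym (sumℕ-vanishing-tail (suc k) (suc n) (λ h → a h * Bell k h b) (s≤s k≤n)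
      (λ h k<h → trans (*-congˡ (BellPolynomials.Bell-vanishes R b k h k<h)) (zeroʳ (a h)))))

  chain-rule : ∀ a b n → (a ∘ₕ b) (suc n) ≈ ((λ₋ a ∘ₕ b) ⋆ λ₋ b) n
  chain-rule a b n = begin
      (a ∘ₕ b) (suc n)
    ≡⟨ ∘ₕ-as-sum a b (suc n) ⟩
      a 0 * 0# + sumℕ N (λ h → a (suc h) * Bell N (suc h) b)
    ≈⟨ +-cong (zeroʳ (a 0)) (sum-cong-≋ {N} (λ h →
         *-congˡ {a (suc (toℕ h))} (BellPolynomials.Bell-recurrence R b n (toℕ h)))) ⟩
      0# + sumℕ N (λ h → a (suc h) * sumℕ N (λ k → term h k))
    ≈⟨ +-identityˡ _ ⟩
      sumℕ N (λ h → a (suc h) * sumℕ N (λ k → term h k))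
    ≈⟨ sum-cong-≋ {N} (λ h → *-distribˡ-sum {N} (a (suc (toℕ h))) (λ k → term (toℕ h) (toℕ k))) ⟩
      ∑[ h < N ] ∑[ k < N ] (a (suc (toℕ h)) * term (toℕ h) (toℕ k))
    ≈⟨ ∑-comm {N} {N} (λ h k → a (suc (toℕ h)) * term (toℕ h) (toℕ k)) ⟩
      ∑[ k < N ] ∑[ h < N ] (a (suc (toℕ h)) * term (toℕ h) (toℕ k))
    ≈⟨ sumℕ-cong N (λ k k<N → sym (inner k (ℕ.≤-pred k<N))) ⟩
      sumℕ N (λ k → fromℕ (n C k) * ((λ₋ a ∘ₕ b) k * b (suc (n ℕ.∸ k))))
    ≡⟨ ≡.sym (⋆-as-sum (λ₋ a ∘ₕ b) (λ₋ b) n) ⟩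
      ((λ₋ a ∘ₕ b) ⋆ λ₋ b) n
    ∎
    where
    N : ℕ
    N = suc n
    term : ℕ → ℕ → Carrier
    term h k = fromℕ (n C k) * (Bell k h b * b (suc (n ℕ.∸ k)))
    inner : ∀ k → k ≤ n →
      fromℕ (n C k) * ((λ₋ a ∘ₕ b) k * b (suc (n ℕ.∸ k))) ≈ sumℕ N (λ h → a (suc h) * term h k)
    inner k k≤n = begin
        fromℕ (n C k) * ((λ₋ a ∘ₕ b) k * b′)
      ≈⟨ *-congˡ (*-congʳ (∘ₕ-as-longer-sum (λ₋ a) b k≤n)) ⟩
        fromℕ (n C k) * (sumℕ N (λ h → a (suc h) * Bell k h b) * b′)
      ≈⟨ *-congˡ (*-distribʳ-sum {N} b′ (λ h → a (suc (toℕ h)) * Bell k (toℕ h) b)) ⟩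
        fromℕ (n C k) * sumℕ N (λ h → (a (suc h) * Bell k h b) * b′)
      ≈⟨ *-distribˡ-sum {N} (fromℕ (n C k)) (λ h → (a (suc (toℕ h)) * Bell k (toℕ h) b) * b′) ⟩
        sumℕ N (λ h → fromℕ (n C k) * ((a (suc h) * Bell k h b) * b′))
      ≈⟨ sum-cong-≋ {N} (λ h → trans (*-congˡ (*-assoc (a (suc (toℕ h))) (Bell k (toℕ h) b) b′))
                                       (x∙yz≈y∙xz (fromℕ (n C k)) (a (suc (toℕ h))) (Bell k (toℕ h) b * b′))) ⟩
        sumℕ N (λ h → a (suc h) * term h k)
      ∎
      where
      b′ : Carrier
      b′ = b (suc (n ℕ.∸ k))

  ⋆-last : ∀ x a i → (x ⋆ a) i ≈ sumℕ i (λ h → fromℕ (i C h) * (x h * a (i ℕ.∸ h))) + x i * a 0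
  ⋆-last x a i = begin
      (x ⋆ a) i
    ≡⟨ ⋆-as-sum x a i ⟩
      sumℕ (suc i) (λ h → fromℕ (i C h) * (x h * a (i ℕ.∸ h)))
    ≈⟨ sumℕ-last i (λ h → fromℕ (i C h) * (x h * a (i ℕ.∸ h))) ⟩
      sumℕ i (λ h → fromℕ (i C h) * (x h * a (i ℕ.∸ h))) + fromℕ (i C i) * (x i * a (i ℕ.∸ i))
    ≈⟨ +-congˡ (trans (*-cong (reflexive (≡.cong fromℕ (nCn≡1 i)))
                              (*-congˡ (reflexive (≡.cong a (ℕ.n∸n≡0 i)))))
                      (trans (*-congʳ (+-identityʳ 1#)) (*-identityˡ _))) ⟩
      sumℕ i (λ h → fromℕ (i C h) * (x h * a (i ℕ.∸ h))) + x i * a 0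
    ∎

  *-cancelʳ-unit : ∀ {u x z} → IsUnit u → x * u ≈ z * u → x ≈ z
  *-cancelʳ-unit {u} {x} {z} (u⁻¹ , uu⁻¹ , _) xu≈zu = begin
      x                ≈⟨ sym (*-identityʳ x) ⟩
      x * 1#           ≈⟨ *-congˡ (sym uu⁻¹) ⟩
      x * (u * u⁻¹)    ≈⟨ sym (*-assoc x u u⁻¹) ⟩
      (x * u) * u⁻¹    ≈⟨ *-congʳ xu≈zu ⟩
      (z * u) * u⁻¹    ≈⟨ *-assoc z u u⁻¹ ⟩
      z * (u * u⁻¹)    ≈⟨ *-congˡ uu⁻¹ ⟩
      z * 1#           ≈⟨ *-identityʳ z ⟩
      z                ∎

  left-⋆-inverse-unique : ∀ a x z → IsUnit (a 0) → (x ⋆ a) ≋ 𝟏 → (z ⋆ a) ≋ 𝟏 → x ≋ z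
  left-⋆-inverse-unique a x z unit x⋆a≋𝟏 z⋆a≋𝟏 = <-rec (λ i → x i ≈ z i) step
    where
    lower : (ℕ → Carrier) → ℕ → Carrier
    lower w i = sumℕ i (λ h → fromℕ (i C h) * (w h * a (i ℕ.∸ h)))
    step : ∀ i → (∀ {h} → h < i → x h ≈ z h) → x i ≈ z i
    step i IH = *-cancelʳ-unit unit (∙-cancelˡ (lower z i) (x i * a 0) (z i * a 0) (begin
        lower z i + x i * a 0
      ≈⟨ +-congʳ (sumℕ-cong i (λ h h<i →
           *-congˡ {fromℕ (i C h)} (*-congʳ {a (i ℕ.∸ h)} (sym (IH h<i))))) ⟩
        lower x i + x i * a 0
      ≈⟨ sym (⋆-last x a i) ⟩
        (x ⋆ a) i
      ≈⟨ trans (x⋆a≋𝟏 i) (sym (z⋆a≋𝟏 i)) ⟩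
        (z ⋆ a) i
      ≈⟨ ⋆-last z a i ⟩
        lower z i + z i * a 0
      ∎))

  λ₋𝕀≋𝟏 : λ₋ 𝕀 ≋ 𝟏
  λ₋𝕀≋𝟏 zero = refl
  λ₋𝕀≋𝟏 (suc n) = refl

  ⋆-inverse-of-derivative : ∀ d b → (d ∘ₕ b) ≋ 𝕀 → ((λ₋ d ∘ₕ b) ⋆ λ₋ b) ≋ 𝟏
  ⋆-inverse-of-derivative d b d∘b≋𝕀 n =
    trans (sym (chain-rule d b n)) (trans (d∘b≋𝕀 (suc n)) (λ₋𝕀≋𝟏 n))

open HurwitzSeries

mainTheorem1 : ∀ {c ℓ : Level} (R : CommutativeRing c ℓ) →
    let open CommutativeRing R
        open Hurwitz R
    in (a : Seq) → IsUnit (a 0) →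
       (ainv : Seq) → IsStarInverse a ainv →
       (d : Seq) → IsCompInverse (λ₊₀ a) d →
       ainv ≋ (λ₋ d ∘ₕ λ₊₀ a)
mainTheorem1 R a unit ainv (_ , ainv⋆a≋𝟏) d (_ , _ , d∘a₊≋𝕀) =
  left-⋆-inverse-unique R a ainv (λ₋ d ∘ₕ λ₊₀ a) unit ainv⋆a≋𝟏
    (⋆-inverse-of-derivative R d (λ₊₀ a) d∘a₊≋𝕀)
  where open Hurwitz R
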